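{- Let $n\geq 3$, $\vec{x}\in\mathbb{Z}^n$ and $m\in\{1,\ldots,l(\vec{x})+2\}$. If $k(\vec{x})<n$ and $\vec{x}(m)\leq\vec{x}(k(\vec{x})+1)$, then $f(\vec{x})=\vec{x}(k(\vec{x})+1)$.
   Context: For $\vec{x}\in\mathbb{Z}^n$ write $\vec{x}(i)$ for its $i$-th entry. $k(\vec{x})=n$ if $\vec{x}(1)>\cdots>\vec{x}(n)$, otherwise the least $k$ with $\vec{x}(k)\leq\vec{x}(k+1)$. $l(\vec{x})$ is the least $l$ with $1\leq l<k(\vec{x})$, $\vec{x}(l)>\vec{x}(l+1)+1$ and $\vec{x}(l+1)=\vec{x}(l+2)+1$ if it exists, otherwise $k(\vec{x})-1$. The function $f:\mathbb{Z}^n\to\mathbb{Z}$ (Bailey–Cowles) is given by: $f(\vec{x})=\vec{x}(1)$ if $k(\vec{x})=n$, and $f(\vec{x})=\max\{\vec{x}(l(\vec{x})+2),\vec{x}(k(\vec{x})+1)\}$ if $k(\vec{x})<n$. -}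

module Defs where

open import Data.Nat using (ℕ; zero; suc; _∸_; _<ᵇ_; _+_)
open import Data.Integer using (ℤ; +_; _≤?_; _≟_; _⊔_) renaming (_+_ to _+ℤ_)
open import Data.Fin using (Fin; zero; suc)
open import Data.Bool using (Bool; true; false; if_then_else_; _∧_; not)
open import Relation.Nullary.Decidable using (⌊_⌋)
open import Function using (_∘_)

-- 1-based entry access: at x i = x(i) for 1 ≤ i ≤ n (out-of-range: 0, never used
-- at the places relevant to the statement).
at : ∀ {n} → (Fin n → ℤ) → ℕ → ℤ
at {zero}  x _ = + 0
at {suc n} x zero = + 0
at {suc n} x (suc zero) = x zero
at {suc n} x (suc (suc i)) = at (x ∘ suc) (suc i)

find : (ℕ → Bool) → (i cnt d : ℕ) → ℕ
find P i zero d = d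
find P i (suc c) d = if P i then i else find P (suc i) c d

-- k(x): n if x(1) > ⋯ > x(n), otherwise least k (1 ≤ k < n) with x(k) ≤ x(k+1)
kk : ∀ {n} → (Fin n → ℤ) → ℕ
kk {n} x = find (λ j → ⌊ at x j ≤? at x (suc j) ⌋) 1 (n ∸ 1) n

-- l(x): least l with 1 ≤ l < k(x), x(l) > x(l+1)+1 and x(l+1) = x(l+2)+1, else k(x)-1
ll : ∀ {n} → (Fin n → ℤ) → ℕ
ll x = find (λ j → not ⌊ at x j ≤? (at x (suc j) +ℤ + 1) ⌋
                   ∧ ⌊ at x (suc j) ≟ (at x (suc (suc j)) +ℤ + 1) ⌋)
            1 (kk x ∸ 1) (kk x ∸ 1)

f : ∀ {n} → (Fin n → ℤ) → ℤ
f {n} x = if kk x <ᵇ n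
          then at x (ll x + 2) ⊔ at x (kk x + 1)
          else at x 1

-- Up to k(x) the entries of x strictly decrease, and l(x) + 2 ≤ k(x) + 1. So either
-- l(x) + 2 = k(x) + 1, or m ≤ l(x) + 2 ≤ k(x) and x(l(x)+2) ≤ x(m) ≤ x(k(x)+1);
-- in both cases the maximum defining f(x) is x(k(x)+1).
module Submission where

open import Defs
open import Data.Nat using (ℕ; _+_; _<_; _≤_; suc; _∸_; _<ᵇ_; s≤s)
import Data.Nat.Properties as ℕ
open import Data.Integer using (ℤ; _⊔_; _≤?_) renaming (_≤_ to _≤ℤ_; _<_ to _<ℤ_)
import Data.Integer.Properties as ℤ
open import Data.Fin using (Fin)
open import Data.Bool using (Bool; true; false)
open import Data.Sum using (_⊎_; inj₁; inj₂)
open import Data.Product using (_×_; _,_)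
open import Data.Empty using (⊥-elim)
open import Relation.Nullary using (yes; no)
open import Relation.Nullary.Decidable using (⌊_⌋)
open import Relation.Binary.PropositionalEquality

find-default⊎inRange : ∀ P i c d →
  find P i c d ≡ d ⊎ (i ≤ find P i c d × find P i c d < i + c)
find-default⊎inRange P i 0 d = inj₁ refl
find-default⊎inRange P i (suc c) d with P i
... | true = inj₂ (ℕ.≤-refl , subst (i <_) (sym (ℕ.+-suc i c)) (ℕ.m≤m+n (suc i) c))
... | false with find-default⊎inRange P (suc i) c d
... | inj₁ e = inj₁ e
... | inj₂ (i<r , r<) = inj₂ (ℕ.<⇒≤ i<r , subst (find P (suc i) c d <_) (sym (ℕ.+-suc i c)) r<)

find-minimal : ∀ P i c d {j} → i ≤ j → j < i + c → j < find P i c d → P j ≡ false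
find-minimal P i 0 d i≤j j<i+0 _ =
  ⊥-elim (ℕ.<-irrefl refl (ℕ.≤-trans j<i+0 (subst (_≤ _) (sym (ℕ.+-identityʳ i)) i≤j)))
find-minimal P i (suc c) d {j} i≤j j<i+c j<r with P i in Pi
... | true = ⊥-elim (ℕ.<-irrefl refl (ℕ.≤-trans j<r i≤j))
... | false with ℕ.m≤n⇒m<n∨m≡n i≤j
... | inj₂ refl = Pi
... | inj₁ i<j = find-minimal P (suc i) c d i<j (subst (j <_) (ℕ.+-suc i c) j<i+c) j<r

strictlyDecreasing⇒antitone : (g : ℕ → ℤ) {a b : ℕ} →
  (∀ {j} → a ≤ j → j < b → g (suc j) <ℤ g j) →
  ∀ {c d} → a ≤ c → c ≤ d → d ≤ b → g d ≤ℤ g c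
strictlyDecreasing⇒antitone g dec {c} {d} a≤c c≤d d≤b with ℕ.m≤n⇒m<n∨m≡n c≤d
... | inj₂ refl = ℤ.≤-refl
strictlyDecreasing⇒antitone g dec {c} {suc d} a≤c _ d<b | inj₁ (s≤s c≤d) =
  ℤ.≤-trans (ℤ.<⇒≤ (dec (ℕ.≤-trans a≤c c≤d) d<b))
            (strictlyDecreasing⇒antitone g dec a≤c c≤d (ℕ.<⇒≤ d<b))

module _ {n : ℕ} (x : Fin n → ℤ) (k<n : kk x < n) where

  private
    Ascent : ℕ → Bool
    Ascent j = ⌊ at x j ≤? at x (suc j) ⌋

  1≤kk : 1 ≤ kk x
  1≤kk with find-default⊎inRange Ascent 1 (n ∸ 1) n
  ... | inj₁ k≡n = ⊥-elim (ℕ.<-irrefl k≡n k<n)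
  ... | inj₂ (1≤k , _) = 1≤k

  at-decreasing-before-kk : ∀ {j} → 1 ≤ j → j < kk x → at x (suc j) <ℤ at x j
  at-decreasing-before-kk {j} 1≤j j<k
    with at x j ≤? at x (suc j)
       | find-minimal Ascent 1 (n ∸ 1) n 1≤j j<n j<k
    where
    j<n : j < 1 + (n ∸ 1)
    j<n = subst (j <_) (sym (ℕ.m+[n∸m]≡n (ℕ.≤-trans 1≤j (ℕ.<⇒≤ (ℕ.<-trans j<k k<n)))))
                (ℕ.<-trans j<k k<n)
  ... | yes _ | ()
  ... | no x[j]≰x[j+1] | _ = ℤ.≰⇒> x[j]≰x[j+1]

  ll+2≤kk+1 : ll x + 2 ≤ kk x + 1
  ll+2≤kk+1 = subst (ll x + 2 ≤_) kk∸1+2≡kk+1 (ℕ.+-monoˡ-≤ 2 ll≤kk∸1)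
    where
    ll≤kk∸1 : ll x ≤ kk x ∸ 1
    ll≤kk∸1 with find-default⊎inRange _ 1 (kk x ∸ 1) (kk x ∸ 1)
    ... | inj₁ l≡ = ℕ.≤-reflexive l≡
    ... | inj₂ (_ , l<) = ℕ.≤-pred l<
    kk∸1+2≡kk+1 : kk x ∸ 1 + 2 ≡ kk x + 1
    kk∸1+2≡kk+1 = begin
      kk x ∸ 1 + 2       ≡⟨ ℕ.+-comm (kk x ∸ 1) 2 ⟩
      suc (1 + (kk x ∸ 1)) ≡⟨ cong suc (ℕ.m+[n∸m]≡n 1≤kk) ⟩
      suc (kk x)         ≡⟨ ℕ.+-comm 1 (kk x) ⟩
      kk x + 1           ∎
      where open ≡-Reasoning

  f-when-kk<n : f x ≡ at x (ll x + 2) ⊔ at x (kk x + 1)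
  f-when-kk<n with kk x <ᵇ n | ℕ.<⇒<ᵇ k<n
  ... | true | _ = refl

lemma3p2 : (n : ℕ) → 3 ≤ n → (x : Fin n → ℤ) → (m : ℕ) → 1 ≤ m → m ≤ ll x + 2 →
    kk x < n → at x m ≤ℤ at x (kk x + 1) → f x ≡ at x (kk x + 1)
lemma3p2 n _ x m 1≤m m≤l+2 k<n x[m]≤x[k+1] =
  trans (f-when-kk<n x k<n) (ℤ.i≤j⇒i⊔j≡j x[l+2]≤x[k+1])
  where
  x[l+2]≤x[k+1] : at x (ll x + 2) ≤ℤ at x (kk x + 1)
  x[l+2]≤x[k+1] with ℕ.m≤n⇒m<n∨m≡n (ll+2≤kk+1 x k<n)
  ... | inj₂ l+2≡k+1 = ℤ.≤-reflexive (cong (at x) l+2≡k+1)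
  ... | inj₁ l+2<k+1 = ℤ.≤-trans
    (strictlyDecreasing⇒antitone (at x) (at-decreasing-before-kk x k<n) 1≤m m≤l+2
      (ℕ.≤-pred (subst (ll x + 2 <_) (ℕ.+-comm (kk x) 1) l+2<k+1)))
    x[m]≤x[k+1]
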